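{- Let $M$ be a standard multigraph, let $v_1,v_2,v_3$ be vertices spanning a $5$-triangle $T$ (pairwise adjacent with total multiplicity $5$), and let $x,y,z$ be three distinct vertices outside $\{v_1,v_2,v_3\}$ with $\mu(x,y)=\mu(y,z)=2$. If $\|x,T\|+\|z,T\|\ge 9$ and $\|y,T\|\ge1$, where $\|u,T\|=\sum_{i=1}^3\mu(u,v_i)$, then the six vertices $\{x,y,z,v_1,v_2,v_3\}$ can be partitioned into two triples, one spanning a $5$-triangle and the other spanning a $4$-triangle.
   Context: Multigraphs have no loops; $\mu(x,y)$ is the number of edges with ends $x,y$; $M$ is standard if $\mu(x,y)\le2$ for all $x,y$. For $k\in\{4,5\}$, a triple $\{p,q,r\}$ spans a $k$-triangle if $p,q,r$ are pairwise adjacent and $\mu(p,q)+\mu(q,r)+\mu(p,r)\ge k$ (a $k$-triangle being a multigraph on three vertices containing $C_3$ with $k$ edges counted with multiplicity). -}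

module Defs where

open import Data.Nat using (ℕ; _+_; _≤_; _≥_; _>_)
open import Data.Fin using (Fin)
open import Data.Product using (_×_)
open import Data.List using (List; _∷_; [])
open import Data.List.Relation.Binary.Permutation.Propositional using (_↭_)
open import Relation.Binary.PropositionalEquality using (_≡_; _≢_)

record Multigraph (n : ℕ) : Set where
  field
    μ     : Fin n → Fin n → ℕ
    sym   : ∀ x y → μ x y ≡ μ y x
    loopless : ∀ x → μ x x ≡ 0

open Multigraph public

Standard : ∀ {n} → Multigraph n → Set
Standard M = ∀ x y → μ M x y ≤ 2

Adjacent : ∀ {n} → Multigraph n → Fin n → Fin n → Set
Adjacent M x y = μ M x y > 0

triMult : ∀ {n} → Multigraph n → Fin n → Fin n → Fin n → ℕ
triMult M p q r = μ M p q + μ M q r + μ M p r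

SpansTriangle : ∀ {n} → ℕ → Multigraph n → Fin n → Fin n → Fin n → Set
SpansTriangle k M p q r =
  Adjacent M p q × Adjacent M q r × Adjacent M p r × triMult M p q r ≥ k

‖_,_‖ : ∀ {n} → Multigraph n → Fin n → Fin n → Fin n → Fin n → ℕ
‖_,_‖ M u v₁ v₂ v₃ = μ M u v₁ + μ M u v₂ + μ M u v₃

{-# OPTIONS --safe #-}
-- By symmetry ‖z,T‖ ≤ ‖x,T‖, so
-- ‖x,T‖ ≥ 5: x is joined to T by double edges, except for at most one simple edge.
-- If that simple edge goes to u, then {x,v,w} is a 5-triangle; it is completed by
-- {y,z,u} when z ~ u, and otherwise ‖z,T‖ ≥ 4 makes {z,v,w} a 5-triangle. If x is
-- doubly joined to u, then {x,y,u} is a 5-triangle, completed by {z,v,w} unless z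
-- sends at most 2 to {v,w}; then z ~ u, and either μ(z,u) = 2 makes {y,z,u} a
-- 5-triangle, or ‖z,T‖ ≤ 3 forces ‖x,T‖ = 6 and {x,v,w} is a 5-triangle.
module Submission where

open import Defs
open import Data.Nat using (ℕ; zero; suc; _+_; _≤_; _≥_; _<_; _>_; z≤n; s≤s; s≤s⁻¹; _≤?_)
open import Data.Nat.Properties
  using (≤-trans; ≤-antisym; ≤-total; +-mono-≤; +-monoˡ-≤; +-monoʳ-≤; +-cancelˡ-≤; +-cancelʳ-≤;
         +-comm; ≰⇒>; <⇒≱; 1+n≰n; +-commutativeSemigroup)
open import Data.Fin using (Fin)
open import Data.Product using (_×_; _,_; ∃-syntax)
open import Data.Sum using (_⊎_; inj₁; inj₂)
open import Data.List using (List; _∷_; [])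
open import Data.List.Relation.Binary.Permutation.Propositional
  using (_↭_; ↭-refl; ↭-sym; ↭-trans; prep; swap)
open import Data.List.Relation.Binary.Permutation.Propositional.Properties using (++-comm; shift)
open import Relation.Binary.PropositionalEquality as ≡ using (_≡_; _≢_; refl; subst; cong₂)
open import Relation.Nullary using (yes; no; contradiction)

open import Algebra.Properties.CommutativeSemigroup +-commutativeSemigroup
  using (xy∙z≈yx∙z; xy∙z≈zx∙y; xy∙z≈xz∙y)

m+n≤o+p⇒m≤o : ∀ {m n o p} → m + n ≤ o + p → p ≤ n → m ≤ o
m+n≤o+p⇒m≤o {m} {n} {o} m+n≤o+p p≤n = +-cancelʳ-≤ n m o (≤-trans m+n≤o+p (+-monoʳ-≤ o p≤n))

larger-summand : ∀ k {m n} → n ≤ m → k + k < m + n → k < m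
larger-summand k n≤m 2k<m+n =
  ≰⇒> λ m≤k → <⇒≱ 2k<m+n (+-mono-≤ m≤k (≤-trans n≤m m≤k))

positive-summand : ∀ {a b c} → a + b + c > 0 → a > 0 ⊎ b > 0 ⊎ c > 0
positive-summand {suc _}          _   = inj₁ (s≤s z≤n)
positive-summand {zero} {suc _}   _   = inj₂ (inj₁ (s≤s z≤n))
positive-summand {zero} {zero}    c>0 = inj₂ (inj₂ c>0)

both-double : ∀ {p r} → p ≤ 2 → r ≤ 2 → p + r ≥ 4 → p ≡ 2 × r ≡ 2
both-double {p} {r} p≤2 r≤2 p+r≥4 =
  ≤-antisym p≤2 (m+n≤o+p⇒m≤o p+r≥4 r≤2) ,
  ≤-antisym r≤2 (m+n≤o+p⇒m≤o (subst (4 ≤_) (+-comm p r) p+r≥4) p≤2)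

-- SpansTriangle k M p q r unfolds to Triangle k (μ M p q) (μ M q r) (μ M p r).
Triangle : ℕ → ℕ → ℕ → ℕ → Set
Triangle k p q r = p > 0 × q > 0 × r > 0 × p + q + r ≥ k

Triangles₅₄ : ℕ → ℕ → ℕ → ℕ → ℕ → ℕ → Set
Triangles₅₄ p q r p′ q′ r′ =
  Triangle 5 p q r × Triangle 4 p′ q′ r′ ⊎ Triangle 4 p q r × Triangle 5 p′ q′ r′

triangle-2qr : ∀ {q r} → q > 0 → r > 0 → Triangle 4 2 q r
triangle-2qr q>0 r>0 = s≤s z≤n , q>0 , r>0 , s≤s (s≤s (+-mono-≤ q>0 r>0))

triangle-2q2 : ∀ {q} → q > 0 → Triangle 5 2 q 2
triangle-2q2 q>0 = s≤s z≤n , q>0 , s≤s z≤n , s≤s (s≤s (+-monoˡ-≤ 2 q>0))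

triangle-22r : ∀ {r} → r > 0 → Triangle 5 2 2 r
triangle-22r r>0 = s≤s z≤n , s≤s z≤n , r>0 , +-monoʳ-≤ 4 r>0

triangle-heavy-pair : ∀ {p q r} → p ≤ 2 → r ≤ 2 → p + r ≥ 3 → q > 0 → Triangle 4 p q r
triangle-heavy-pair {p} {q} {r} p≤2 r≤2 p+r≥3 q>0 =
  m+n≤o+p⇒m≤o p+r≥3 r≤2 ,
  q>0 ,
  m+n≤o+p⇒m≤o (subst (3 ≤_) (+-comm p r) p+r≥3) p≤2 ,
  subst (4 ≤_) (xy∙z≈xz∙y p r q) (+-mono-≤ p+r≥3 q>0)

-- In the numeric lemmas below, au av aw are the multiplicities from x to the apex u and to
-- v, w, cu cv cw those from z, b = μ(y,u) and t = μ(v,w); the first alternative of the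
-- conclusion describes the triples (x,y,u), (z,v,w), the second (y,z,u), (x,v,w).

split-simple-apex : ∀ {b cu cv cw t} →
  cv ≤ 2 → cw ≤ 2 → b > 0 → t > 0 → cu + cv + cw ≥ 4 →
  Triangles₅₄ 2 b 1 cv t cw ⊎ Triangles₅₄ 2 cu b 2 t 2
split-simple-apex {cu = zero} cv≤2 cw≤2 b>0 t>0 cv+cw≥4
  with both-double cv≤2 cw≤2 cv+cw≥4
... | refl , refl = inj₁ (inj₂ (triangle-2qr b>0 (s≤s z≤n) , triangle-2q2 t>0))
split-simple-apex {cu = suc _} _ _ b>0 t>0 _ =
  inj₂ (inj₂ (triangle-2qr (s≤s z≤n) b>0 , triangle-2q2 t>0))

split-double-apex : ∀ {av aw b cu cv cw t} →
  av ≤ 2 → aw ≤ 2 → cu ≤ 2 → cv ≤ 2 → cw ≤ 2 → b > 0 → t > 0 →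
  av + aw ≥ 3 → 2 + av + aw + (cu + cv + cw) ≥ 9 →
  Triangles₅₄ 2 b 2 cv t cw ⊎ Triangles₅₄ 2 cu b av t aw
split-double-apex {cv = cv} {cw} av≤2 aw≤2 cu≤2 cv≤2 cw≤2 b>0 t>0 av+aw≥3 X+Z≥9
  with 3 ≤? cv + cw
... | yes cv+cw≥3 =
  inj₁ (inj₁ (triangle-2q2 b>0 , triangle-heavy-pair cv≤2 cw≤2 cv+cw≥3 t>0))
split-double-apex {av} {aw} av≤2 aw≤2 z≤n _ _ _ _ _ X+Z≥9 | no cv+cw≱3 =
  contradiction (≤-trans X+Z≥9 (+-mono-≤ X≤6 (s≤s⁻¹ (≰⇒> cv+cw≱3)))) 1+n≰n
  where
  X≤6 : 2 + av + aw ≤ 6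
  X≤6 = s≤s (s≤s (+-mono-≤ av≤2 aw≤2))
split-double-apex av≤2 aw≤2 (s≤s z≤n) _ _ b>0 t>0 _ X+Z≥9 | no cv+cw≱3
  with both-double av≤2 aw≤2 (s≤s⁻¹ (s≤s⁻¹ (m+n≤o+p⇒m≤o {m = 6} X+Z≥9 (≰⇒> cv+cw≱3))))
... | refl , refl = inj₂ (inj₂ (triangle-2qr (s≤s z≤n) b>0 , triangle-2q2 t>0))
split-double-apex av≤2 aw≤2 (s≤s (s≤s z≤n)) _ _ b>0 t>0 av+aw≥3 _ | no _ =
  inj₂ (inj₁ (triangle-22r b>0 , triangle-heavy-pair av≤2 aw≤2 av+aw≥3 t>0))

split-multiplicities : ∀ {xy yz au av aw b cu cv cw t} → xy ≡ 2 → yz ≡ 2 →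
  au ≤ 2 → av ≤ 2 → aw ≤ 2 → cu ≤ 2 → cv ≤ 2 → cw ≤ 2 → b > 0 → t > 0 →
  cu + cv + cw ≤ au + av + aw → au + av + aw + (cu + cv + cw) ≥ 9 →
  Triangles₅₄ xy b au cv t cw ⊎ Triangles₅₄ yz cu b av t aw
split-multiplicities refl refl z≤n av≤2 aw≤2 _ _ _ _ _ Z≤X X+Z≥9 =
  contradiction (≤-trans (larger-summand 4 Z≤X X+Z≥9) (+-mono-≤ av≤2 aw≤2)) 1+n≰n
split-multiplicities refl refl (s≤s z≤n) av≤2 aw≤2 _ cv≤2 cw≤2 b>0 t>0 Z≤X X+Z≥9
  with both-double av≤2 aw≤2 (s≤s⁻¹ (larger-summand 4 Z≤X X+Z≥9))
... | refl , refl = split-simple-apex cv≤2 cw≤2 b>0 t>0 (+-cancelˡ-≤ 5 4 _ X+Z≥9)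
split-multiplicities refl refl (s≤s (s≤s z≤n)) av≤2 aw≤2 cu≤2 cv≤2 cw≤2 b>0 t>0 Z≤X X+Z≥9 =
  split-double-apex av≤2 aw≤2 cu≤2 cv≤2 cw≤2 b>0 t>0
    (s≤s⁻¹ (s≤s⁻¹ (larger-summand 4 Z≤X X+Z≥9))) X+Z≥9

module _ {n} (M : Multigraph n) where

  Splits₅₄ : List (Fin n) → Set
  Splits₅₄ vs = ∃[ a ] ∃[ b ] ∃[ c ] ∃[ d ] ∃[ e ] ∃[ f ]
    ((a ∷ b ∷ c ∷ d ∷ e ∷ f ∷ []) ↭ vs × SpansTriangle 5 M a b c × SpansTriangle 4 M d e f)

  Splits₅₄-resp-↭ : ∀ {vs ws} → vs ↭ ws → Splits₅₄ vs → Splits₅₄ ws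
  Splits₅₄-resp-↭ vs↭ws (a , b , c , d , e , f , abcdef↭vs , abc , def) =
    a , b , c , d , e , f , ↭-trans abcdef↭vs vs↭ws , abc , def

  triangles⇒Splits₅₄ : ∀ {a b c d e f} →
    Triangles₅₄ (μ M a b) (μ M b c) (μ M a c) (μ M d e) (μ M e f) (μ M d f) →
    Splits₅₄ (a ∷ b ∷ c ∷ d ∷ e ∷ f ∷ [])
  triangles⇒Splits₅₄ {a} {b} {c} {d} {e} {f} (inj₁ (abc , def)) =
    a , b , c , d , e , f , ↭-refl , abc , def
  triangles⇒Splits₅₄ {a} {b} {c} {d} {e} {f} (inj₂ (abc , def)) =
    d , e , f , a , b , c , ++-comm (d ∷ e ∷ f ∷ []) (a ∷ b ∷ c ∷ []) , def , abc

  ‖‖-swap : ∀ p a b c → ‖ M , p ‖ a b c ≡ ‖ M , p ‖ b a c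
  ‖‖-swap p a b c = xy∙z≈yx∙z (μ M p a) (μ M p b) (μ M p c)

  ‖‖-rotate : ∀ p a b c → ‖ M , p ‖ a b c ≡ ‖ M , p ‖ c a b
  ‖‖-rotate p a b c = xy∙z≈zx∙y (μ M p a) (μ M p b) (μ M p c)

  split-heavier-x : Standard M → ∀ {x y z u v w} →
    μ M x y ≡ 2 → μ M y z ≡ 2 → Adjacent M y u → Adjacent M v w →
    ‖ M , z ‖ u v w ≤ ‖ M , x ‖ u v w → ‖ M , x ‖ u v w + ‖ M , z ‖ u v w ≥ 9 →
    Splits₅₄ (x ∷ y ∷ z ∷ u ∷ v ∷ w ∷ [])
  split-heavier-x std {x} {y} {z} {u} {v} {w} xy≡2 yz≡2 y~u v~w Z≤X X+Z≥9
    with split-multiplicities xy≡2 yz≡2 (std x u) (std x v) (std x w)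
                              (std z u) (std z v) (std z w) y~u v~w Z≤X X+Z≥9
  ... | inj₁ xyu,zvw =
    Splits₅₄-resp-↭ (prep x (prep y (swap u z ↭-refl))) (triangles⇒Splits₅₄ xyu,zvw)
  ... | inj₂ yzu,xvw =
    Splits₅₄-resp-↭ (shift x (y ∷ z ∷ u ∷ []) (v ∷ w ∷ [])) (triangles⇒Splits₅₄ yzu,xvw)

  split-at-apex : Standard M → ∀ {x y z u v w} →
    μ M x y ≡ 2 → μ M y z ≡ 2 → Adjacent M y u → Adjacent M v w →
    ‖ M , x ‖ u v w + ‖ M , z ‖ u v w ≥ 9 → Splits₅₄ (x ∷ y ∷ z ∷ u ∷ v ∷ w ∷ [])
  split-at-apex std {x} {y} {z} {u} {v} {w} xy≡2 yz≡2 y~u v~w X+Z≥9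
    with ≤-total (‖ M , z ‖ u v w) (‖ M , x ‖ u v w)
  ... | inj₁ Z≤X = split-heavier-x std xy≡2 yz≡2 y~u v~w Z≤X X+Z≥9
  ... | inj₂ X≤Z =
    Splits₅₄-resp-↭ (↭-trans (shift x (z ∷ y ∷ []) _) (prep x (swap z y ↭-refl)))
      (split-heavier-x std zy≡2 yx≡2 y~u v~w X≤Z
        (subst (9 ≤_) (+-comm (‖ M , x ‖ u v w) _) X+Z≥9))
    where
    zy≡2 : μ M z y ≡ 2
    zy≡2 = ≡.trans (sym M z y) yz≡2
    yx≡2 : μ M y x ≡ 2
    yx≡2 = ≡.trans (sym M y x) xy≡2

proposition16 : ∀ {n} (M : Multigraph n) → Standard M →
    (v₁ v₂ v₃ x y z : Fin n) →
    v₁ ≢ v₂ → v₂ ≢ v₃ → v₁ ≢ v₃ →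
    Adjacent M v₁ v₂ → Adjacent M v₂ v₃ → Adjacent M v₁ v₃ →
    triMult M v₁ v₂ v₃ ≡ 5 →
    x ≢ y → y ≢ z → x ≢ z →
    x ≢ v₁ → x ≢ v₂ → x ≢ v₃ →
    y ≢ v₁ → y ≢ v₂ → y ≢ v₃ →
    z ≢ v₁ → z ≢ v₂ → z ≢ v₃ →
    μ M x y ≡ 2 → μ M y z ≡ 2 →
    ‖ M , x ‖ v₁ v₂ v₃ + ‖ M , z ‖ v₁ v₂ v₃ ≥ 9 →
    ‖ M , y ‖ v₁ v₂ v₃ ≥ 1 →
    ∃[ a ] ∃[ b ] ∃[ c ] ∃[ d ] ∃[ e ] ∃[ f ]
    ((a ∷ b ∷ c ∷ d ∷ e ∷ f ∷ []) ↭ (x ∷ y ∷ z ∷ v₁ ∷ v₂ ∷ v₃ ∷ [])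
    × SpansTriangle 5 M a b c × SpansTriangle 4 M d e f)
proposition16 M std v₁ v₂ v₃ x y z _ _ _ v₁~v₂ v₂~v₃ v₁~v₃ _ _ _ _ _ _ _ _ _ _ _ _ _
             xy≡2 yz≡2 X+Z≥9 y~T
  with positive-summand y~T
... | inj₁ y~v₁ = split-at-apex M std xy≡2 yz≡2 y~v₁ v₂~v₃ X+Z≥9
... | inj₂ (inj₁ y~v₂) =
  Splits₅₄-resp-↭ M (prep x (prep y (prep z (swap v₂ v₁ ↭-refl))))
  (split-at-apex M std xy≡2 yz≡2 y~v₂ v₁~v₃
    (subst (9 ≤_) (cong₂ _+_ (‖‖-swap M x v₁ v₂ v₃) (‖‖-swap M z v₁ v₂ v₃)) X+Z≥9))
... | inj₂ (inj₂ y~v₃) =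
  Splits₅₄-resp-↭ M (prep x (prep y (prep z (↭-sym (shift v₃ (v₁ ∷ v₂ ∷ []) [])))))
  (split-at-apex M std xy≡2 yz≡2 y~v₃ v₁~v₂
    (subst (9 ≤_) (cong₂ _+_ (‖‖-rotate M x v₁ v₂ v₃) (‖‖-rotate M z v₁ v₂ v₃)) X+Z≥9))
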